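{- Let $n\geq 1$, let $p(z)$ be any monic polynomial of degree $n$, and let $\mathcal{M}_n$ be the family of all $n\times n$ matrices with entries in $\{ -1,+1\}$. Then $$L_n = 2^{ -n^2}\sum_{X\in\mathcal{M}_n} p(\mathrm{Per}\,X)\,\pi(X),$$ where $\mathrm{Per}\,X$ is the permanent of $X$ and $\pi(X)$ is the product of all the entries of $X$.
   Context: A Latin square of order $n$ is an $n\times n$ array with entries from $\{1,\dots,n\}$ in which each row and each column contains each symbol exactly once. $L_n$ denotes the total number of Latin squares of order $n$. -}

module Defs where

open import Level using (Level)
open import Data.Nat using (ℕ; zero; suc)
open import Data.Fin using (Fin; zero; suc; _≟_; toℕ)
open import Data.Fin.Properties using (all?; any?)
open import Data.List using (List; []; _∷_; [_]; map; concatMap; filter; length; foldr; allFin)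
open import Data.Product using (_×_; ∃)
open import Data.Vec.Functional using () renaming (_∷_ to _∷ᶠ_)
open import Relation.Binary.PropositionalEquality using (_≡_)
open import Relation.Nullary using (Dec; _×-dec_; _→-dec_)
open import Data.Nat.Properties as ℕP using ()
open import Algebra.Bundles using (CommutativeRing)

allFuns : ∀ {a} {A : Set a} (m : ℕ) → List A → List (Fin m → A)
allFuns zero    xs = [ (λ ()) ]
allFuns (suc m) xs = concatMap (λ x → map (λ f → x ∷ᶠ f) (allFuns m xs)) xs

-- Latin squares of order n: n×n arrays with entries in Fin n (symbols
-- 1..n encoded as Fin n) in which every row and every column contains
-- each symbol exactly once.

Array : ℕ → Set
Array n = Fin n → Fin n → Fin n

occurrences : ∀ {n} → (Fin n → Fin n) → Fin n → ℕ
occurrences {n} row s = length (filter (λ j → row j ≟ s) (allFin n))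

IsLatin : ∀ {n} → Array n → Set
IsLatin {n} M =
  (∀ (i s : Fin n) → occurrences (λ j → M i j) s ≡ 1) ×
  (∀ (j s : Fin n) → occurrences (λ i → M i j) s ≡ 1)

isLatin? : ∀ {n} (M : Array n) → Dec (IsLatin M)
isLatin? M =
  all? (λ i → all? (λ s → occurrences (λ j → M i j) s ℕP.≟ 1)) ×-dec
  all? (λ j → all? (λ s → occurrences (λ i → M i j) s ℕP.≟ 1))

L : ℕ → ℕ
L n = length (filter isLatin? (allFuns n (allFuns n (allFin n))))

IsPerm : ∀ {n} → (Fin n → Fin n) → Set
IsPerm {n} σ = (∀ (i j : Fin n) → σ i ≡ σ j → i ≡ j) × (∀ (k : Fin n) → ∃ λ i → σ i ≡ k)

isPerm? : ∀ {n} (σ : Fin n → Fin n) → Dec (IsPerm σ)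
isPerm? σ = all? (λ i → all? (λ j → (σ i ≟ σ j) →-dec (i ≟ j))) ×-dec
            all? (λ k → any? (λ i → σ i ≟ k))

perms : (n : ℕ) → List (Fin n → Fin n)
perms n = filter isPerm? (allFuns n (allFin n))

data PM : Set where
  plus minus : PM

allPM : List PM
allPM = plus ∷ minus ∷ []

SignMatrix : ℕ → Set
SignMatrix n = Fin n → Fin n → PM

allSignMatrices : (n : ℕ) → List (SignMatrix n)
allSignMatrices n = allFuns n (allFuns n allPM)

module _ {c ℓ : Level} (R : CommutativeRing c ℓ) where
  open CommutativeRing R

  ⟦_⟧ : PM → Carrier
  ⟦ plus ⟧  = 1#
  ⟦ minus ⟧ = - 1#

  sumL : List Carrier → Carrier
  sumL = foldr _+_ 0#

  prodL : List Carrier → Carrier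
  prodL = foldr _*_ 1#

  Σ< : (n : ℕ) → (Fin n → Carrier) → Carrier
  Σ< n f = sumL (map f (allFin n))

  Π< : (n : ℕ) → (Fin n → Carrier) → Carrier
  Π< n f = prodL (map f (allFin n))

  pow : Carrier → ℕ → Carrier
  pow x zero    = 1#
  pow x (suc k) = x * pow x k

  fromℕ : ℕ → Carrier
  fromℕ zero    = 0#
  fromℕ (suc k) = 1# + fromℕ k

  Per : ∀ {n} → SignMatrix n → Carrier
  Per {n} X = sumL (map (λ σ → Π< n (λ i → ⟦ X i (σ i) ⟧)) (perms n))

  πX : ∀ {n} → SignMatrix n → Carrier
  πX {n} X = Π< n (λ i → Π< n (λ j → ⟦ X i j ⟧))

  evalMonic : (n : ℕ) → (Fin n → Carrier) → Carrier → Carrier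
  evalMonic n a z = pow z n + Σ< n (λ k → a k * pow z (toℕ k))

module Submission where

-- Write x_ij = X i j ∈ {±1} and, for a k-tuple τ of maps Fin n → Fin n,
-- cover τ i j = #{l | τ_l(i) = j}.  Expanding Per(X)^k as a sum over k-tuples
-- of permutations and multiplying by π(X) gives
--   Per(X)^k π(X) = Σ_τ ∏_{i,j} x_ij^(cover τ i j + 1),
-- and summing over all ±1 matrices factorises entrywise, since
-- Σ_{s=±1} s^(c+1) is 2 for odd c and 0 for even c.  Hence the k-th moment
-- Σ_X Per(X)^k π(X) is 2^(n²) times the number of k-tuples of permutations
-- covering every cell an odd number of times.  For k < n some cell is not
-- covered at all (pigeonhole), so these moments vanish and only the leading
-- term zⁿ of p survives.  For k = n the tuples covering every cell oddly
-- correspond bijectively to Latin squares (M i j = the l with τ_l(i) = j),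
-- which a double counting argument turns into the count L n.

open import Defs
open import Level using (Level)
open import Data.Nat as ℕ using (ℕ; _≤_)
open import Data.Fin using (Fin)
open import Data.List using (map)
open import Algebra.Bundles using (CommutativeRing)

open import Data.Nat using (zero; suc; _<_; parity)
open import Data.Nat.Properties using (n<1+n; 1+n≢0)
open import Data.Fin using (zero; suc; _≟_; toℕ; fromℕ<; punchOut)
open import Data.Fin.Properties
  using (all?; any?; ¬∀⟶∃¬; <⇒notInjective; punchOut-injective; suc-injective; 0≢1+n; toℕ<n)
open import Data.Parity using (0ℙ; 1ℙ)
open import Data.Parity.Properties using () renaming (_≟_ to _≟ℙ_)
open import Data.List using (List; []; _∷_; _++_; filter; length; concatMap; allFin; tabulate)
open import Data.List.Properties using (filter-none; map-tabulate; map-∘)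
open import Data.List.Relation.Unary.All as All using (All; []; _∷_)
open import Data.List.Relation.Unary.All.Properties using (tabulate⁺; all-filter; map⁺; concat⁺)
open import Data.List.Relation.Unary.Any using (here; there)
open import Data.List.Membership.Propositional using (_∈_)
open import Data.List.Membership.Propositional.Properties using (∈-allFin)
open import Data.Vec.Functional using () renaming (_∷_ to _∷ᶠ_)
open import Data.Vec.Functional.Relation.Binary.Pointwise using (Pointwise)
open import Data.Vec.Functional.Relation.Binary.Pointwise.Properties using () renaming (decidable to pointwise?)
open import Data.Bool using (true; false; if_then_else_)
open import Data.Product using (∃; _×_; _,_; proj₁; proj₂; uncurry)
open import Data.Empty using (⊥-elim)
open import Function using (_∘_; Injective)
open import Relation.Nullary using (Dec; yes; no; does; ¬_; _×-dec_; contradiction)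
open import Relation.Unary using (Pred; Decidable)
open import Relation.Binary.Core using (Rel)
open import Relation.Binary.Definitions using () renaming (Decidable to Decidable₂)
open import Relation.Binary.PropositionalEquality as ≡ using (_≡_; _≢_)

private
  variable
    a b p q r s : Level
    A : Set a
    B : Set b

-- Counting, pigeonhole and inversion for maps between finite sets

module FinMaps where
  open ≡ using (refl; sym; trans; cong)

  hits : ∀ {k n} → (Fin k → Fin n) → Fin n → ℕ
  hits {k} f s = length (filter (λ l → f l ≟ s) (allFin k))

  count-unique : ∀ {k} {P : Pred B p} (P? : Decidable P) (g : Fin k → B) (a : Fin k) →
                 P (g a) → (∀ l → P (g l) → l ≡ a) → length (filter P? (tabulate g)) ≡ 1
  count-unique P? g zero Pga unique with P? (g zero)
  ... | yes _   = cong (suc ∘ length)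
                       (filter-none P? (tabulate⁺ (λ l Pgl → 0≢1+n (sym (unique (suc l) Pgl)))))
  ... | no ¬Pga = contradiction Pga ¬Pga
  count-unique P? g (suc a) Pga unique with P? (g zero)
  ... | yes P0 = contradiction (unique zero P0) 0≢1+n
  ... | no _   = count-unique P? (g ∘ suc) a Pga (λ l Pgl → suc-injective (unique (suc l) Pgl))

  hits-unique : ∀ {k n} (f : Fin k → Fin n) {s} a →
                f a ≡ s → (∀ l → f l ≡ s → l ≡ a) → hits f s ≡ 1
  hits-unique f = count-unique (λ l → f l ≟ _) (λ l → l)

  hits-none : ∀ {k n} (f : Fin k → Fin n) {s} → (∀ l → f l ≢ s) → hits f s ≡ 0
  hits-none f missed = cong length (filter-none _ (tabulate⁺ missed))

  hit-exists : ∀ {k n} (f : Fin k → Fin n) {s} → hits f s ≢ 0 → ∃ λ l → f l ≡ s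
  hit-exists f {s} nonzero with any? (λ l → f l ≟ s)
  ... | yes hit = hit
  ... | no none = contradiction (hits-none f (λ l e → none (l , e))) nonzero

  Onto : ∀ {k n} → (Fin k → Fin n) → Set
  Onto f = ∀ s → ∃ λ l → f l ≡ s

  section-injective : ∀ {k n} (f : Fin k → Fin n) (h : Fin n → Fin k) →
                      (∀ s → f (h s) ≡ s) → Injective _≡_ _≡_ h
  section-injective f h fh {s} {t} hs≡ht = trans (sym (fh s)) (trans (cong f hs≡ht) (fh t))

  misses : ∀ {k n} (f : Fin k → Fin n) → k < n → ∃ λ s → ∀ l → f l ≢ s
  misses {n = n} f k<n with all? (λ s → any? (λ l → f l ≟ s))
  ... | yes onto = ⊥-elim (<⇒notInjective k<n (section-injective f (proj₁ ∘ onto) (proj₂ ∘ onto)))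
  ... | no ¬onto with ¬∀⟶∃¬ n _ (λ s → any? (λ l → f l ≟ s)) ¬onto
  ...   | s , ¬hit = s , λ l e → ¬hit (l , e)

  injective⇒onto : ∀ {n} (f : Fin n → Fin n) → Injective _≡_ _≡_ f → Onto f
  injective⇒onto {suc m} f injective c with any? (λ x → f x ≟ c)
  ... | yes hit = hit
  ... | no miss = ⊥-elim (<⇒notInjective (n<1+n m) h-injective)
    where
    c≢f : ∀ x → c ≢ f x
    c≢f x c≡fx = miss (x , sym c≡fx)
    h : Fin (suc m) → Fin m
    h x = punchOut (c≢f x)
    h-injective : Injective _≡_ _≡_ h
    h-injective {x} {y} e = injective (punchOut-injective (c≢f x) (c≢f y) e)

  -- Conversely an onto self-map of Fin n is injective: its section h is an
  -- injective self-map, hence onto, and f ∘ h = id.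
  onto⇒injective : ∀ {n} (f : Fin n → Fin n) → Onto f → Injective _≡_ _≡_ f
  onto⇒injective {n} f onto {x} {y} fx≡fy = begin
    x                      ≡⟨ sym (proj₂ (h-onto x)) ⟩
    h (proj₁ (h-onto x))   ≡⟨ cong h preimages-equal ⟩
    h (proj₁ (h-onto y))   ≡⟨ proj₂ (h-onto y) ⟩
    y                      ∎
    where
    open ≡.≡-Reasoning
    h : Fin n → Fin n
    h = proj₁ ∘ onto
    fh : ∀ s → f (h s) ≡ s
    fh = proj₂ ∘ onto
    h-onto : Onto h
    h-onto = injective⇒onto h (section-injective f h fh)
    preimages-equal : proj₁ (h-onto x) ≡ proj₁ (h-onto y)
    preimages-equal = begin
      proj₁ (h-onto x)        ≡⟨ sym (fh _) ⟩
      f (h (proj₁ (h-onto x))) ≡⟨ cong f (proj₂ (h-onto x)) ⟩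
      f x                      ≡⟨ fx≡fy ⟩
      f y                      ≡⟨ cong f (sym (proj₂ (h-onto y))) ⟩
      f (h (proj₁ (h-onto y))) ≡⟨ fh _ ⟩
      proj₁ (h-onto y)         ∎

  -- a preimage of s under f (defaulting to s when there is none)
  invert : ∀ {n} → (Fin n → Fin n) → Fin n → Fin n
  invert f s with any? (λ l → f l ≟ s)
  ... | yes (l , _) = l
  ... | no _        = s

  invert-section : ∀ {n} {f : Fin n → Fin n} → Onto f → ∀ s → f (invert f s) ≡ s
  invert-section {f = f} onto s with any? (λ l → f l ≟ s)
  ... | yes (_ , fl≡s) = fl≡s
  ... | no none        = contradiction (onto s) none

  invert-unique : ∀ {n} {f : Fin n → Fin n} → Onto f → ∀ {l s} → f l ≡ s → invert f s ≡ l
  invert-unique {f = f} onto {l} {s} fl≡s =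
    onto⇒injective f onto (trans (invert-section onto s) (sym fl≡s))

  allFuns-All : ∀ {S : Pred A p} m {xs} → All S xs → All (λ f → ∀ i → S (f i)) (allFuns m xs)
  allFuns-All zero    Sxs = (λ ()) ∷ []
  allFuns-All {A = A} {S = S} (suc m) Sxs =
    concat⁺ (map⁺ (All.map (λ Sx → map⁺ (All.map (cons Sx) (allFuns-All m Sxs))) Sxs))
    where
    cons : ∀ {x} {f : Fin m → A} → S x → (∀ i → S (f i)) → ∀ i → S ((x ∷ᶠ f) i)
    cons Sx Sf zero    = Sx
    cons Sx Sf (suc i) = Sf i

module Covers where
  open FinMaps

  cover : ∀ {k n} → (Fin k → Fin n → Fin n) → Fin n → Fin n → ℕ
  cover τ i j = hits (λ l → τ l i) j

  OddCover : ∀ {k n} → (Fin k → Fin n → Fin n) → Set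
  OddCover τ = ∀ i j → parity (cover τ i j) ≡ 1ℙ

  oddCover? : ∀ {k n} → Decidable (OddCover {k} {n})
  oddCover? τ = all? λ i → all? λ j → parity (cover τ i j) ≟ℙ 1ℙ

module LatinTuples (n : ℕ) where
  open ≡ using (refl; sym; trans; cong)
  open FinMaps
  open Covers

  -- arrays and n-tuples of self-maps share the type Fin n → Fin n → Fin n
  _≋_ : Rel (Fin n → Fin n → Fin n) _
  _≋_ = Pointwise (Pointwise _≡_)

  LatinTuple : (Fin n → Fin n → Fin n) → Set
  LatinTuple τ = (∀ l → IsPerm (τ l)) × OddCover τ

  latinTuple? : Decidable LatinTuple
  latinTuple? τ = all? (λ l → isPerm? (τ l)) ×-dec oddCover? τ

  square : (Fin n → Fin n → Fin n) → Array n
  square τ i j = invert (λ l → τ l i) j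

  tuple : Array n → (Fin n → Fin n → Fin n)
  tuple M l i = invert (M i) l

  odd⇒nonzero : ∀ {c} → parity c ≡ 1ℙ → c ≢ 0
  odd⇒nonzero {zero}  ()
  odd⇒nonzero {suc c} _ ()

  cover-onto : ∀ {τ : Fin n → Fin n → Fin n} → OddCover τ → ∀ i → Onto (λ l → τ l i)
  cover-onto odd i j = hit-exists _ (odd⇒nonzero (odd i j))

  once⇒onto : ∀ (f : Fin n → Fin n) → (∀ s → hits f s ≡ 1) → Onto f
  once⇒onto f once s = hit-exists f (λ hits≡0 → 1+n≢0 (trans (sym (once s)) hits≡0))

  latin-rows : ∀ {M : Array n} → IsLatin M → ∀ i → Onto (M i)
  latin-rows (rows , _) i = once⇒onto _ (rows i)

  latin-columns : ∀ {M : Array n} → IsLatin M → ∀ j → Onto (λ i → M i j)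
  latin-columns (_ , columns) j = once⇒onto _ (columns j)

  square-spec : ∀ {τ M} → OddCover τ → M ≋ square τ → ∀ i j → τ (M i j) i ≡ j
  square-spec {τ} odd M≋ i j = trans (cong (λ l → τ l i) (M≋ i j)) (invert-section (cover-onto odd i) j)

  square-unique : ∀ {τ M} → OddCover τ → M ≋ square τ → ∀ {i j l} → τ l i ≡ j → M i j ≡ l
  square-unique odd M≋ {i} {j} τli≡j = trans (M≋ i j) (invert-unique (cover-onto odd i) τli≡j)

  tuple-spec : ∀ {M τ} → IsLatin M → τ ≋ tuple M → ∀ l i → M i (τ l i) ≡ l
  tuple-spec {M} latin τ≋ l i = trans (cong (M i) (τ≋ l i)) (invert-section (latin-rows latin i) l)

  tuple-unique : ∀ {M τ} → IsLatin M → τ ≋ tuple M → ∀ {l i j} → M i j ≡ l → τ l i ≡ j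
  tuple-unique latin τ≋ {l} {i} Mij≡l = trans (τ≋ l i) (invert-unique (latin-rows latin i) Mij≡l)

  -- The square of a Latin tuple is a Latin square: row i contains symbol s
  -- exactly at column τ_s(i), and column j exactly at row τ_s⁻¹(j).
  square-latin : ∀ {τ M} → LatinTuple τ → M ≋ square τ → IsLatin M
  square-latin {τ} {M} (perm , odd) M≋ = rows , columns
    where
    rows : ∀ i s → occurrences (λ j → M i j) s ≡ 1
    rows i s = hits-unique (M i) (τ s i) (square-unique odd M≋ refl)
      (λ j Mij≡s → trans (sym (square-spec odd M≋ i j)) (cong (λ l → τ l i) Mij≡s))
    columns : ∀ j s → occurrences (λ i → M i j) s ≡ 1
    columns j s with proj₂ (perm s) j
    ... | a , τsa≡j = hits-unique (λ i → M i j) a (square-unique odd M≋ τsa≡j)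
      (λ i Mij≡s → proj₁ (perm s) i a
        (trans (trans (cong (λ l → τ l i) (sym Mij≡s)) (square-spec odd M≋ i j)) (sym τsa≡j)))

  -- The tuple of a Latin square is a Latin tuple: each τ_l is a permutation
  -- (as columns are injective and onto) and cell (i,j) is covered only by l = M i j.
  tuple-latinTuple : ∀ {M τ} → IsLatin M → τ ≋ tuple M → LatinTuple τ
  tuple-latinTuple {M} {τ} latin τ≋ = perm , odd
    where
    perm : ∀ l → IsPerm (τ l)
    perm l = (λ i i' τli≡τli' → onto⇒injective (λ x → M x (τ l i)) (latin-columns latin (τ l i))
                (trans (tuple-spec latin τ≋ l i)
                       (sym (trans (cong (M i') τli≡τli') (tuple-spec latin τ≋ l i')))))
           , (λ k → let (i , Mik≡l) = latin-columns latin k l in i , tuple-unique latin τ≋ Mik≡l)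
    odd : OddCover τ
    odd i j = cong parity (hits-unique (λ l → τ l i) (M i j) (tuple-unique latin τ≋ refl)
                (λ l τli≡j → trans (sym (tuple-spec latin τ≋ l i)) (cong (M i) τli≡j)))

  square-tuple : ∀ {τ M} → LatinTuple τ → M ≋ square τ → IsLatin M × τ ≋ tuple M
  square-tuple (perm , odd) M≋ =
    latin , λ l i → sym (tuple-unique latin (λ _ _ → refl) (square-unique odd M≋ refl))
    where
    latin : IsLatin _
    latin = square-latin (perm , odd) M≋

  tuple-square : ∀ {τ M} → IsLatin M → τ ≋ tuple M → LatinTuple τ × M ≋ square τ
  tuple-square latin τ≋ =
    lt , λ i j → sym (square-unique (proj₂ lt) (λ _ _ → refl) (tuple-unique latin τ≋ refl))
    where
    lt : LatinTuple _
    lt = tuple-latinTuple latin τ≋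

-- Finite sums and products in a commutative ring

module BigOperators {c ℓ} (R : CommutativeRing c ℓ) where
  open CommutativeRing R hiding (zero)
  open import Relation.Binary.Reasoning.Setoid setoid
  open import Algebra.Properties.CommutativeSemigroup +-commutativeSemigroup
    using () renaming (interchange to +-interchange)
  open import Algebra.Properties.CommutativeSemigroup *-commutativeSemigroup
    using () renaming (interchange to *-interchange)

  ∑ : List A → (A → Carrier) → Carrier
  ∑ xs f = sumL R (map f xs)

  ∏ : List A → (A → Carrier) → Carrier
  ∏ xs f = prodL R (map f xs)

  syntax ∑ xs (λ x → e) = ∑[ x ∈ xs ] e
  syntax ∏ xs (λ x → e) = ∏[ x ∈ xs ] e

  ∑-congᴬ : ∀ {f g : A → Carrier} {xs} → All (λ x → f x ≈ g x) xs → ∑ xs f ≈ ∑ xs g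
  ∑-congᴬ []       = refl
  ∑-congᴬ (e ∷ es) = +-cong e (∑-congᴬ es)

  ∑-cong : ∀ {f g : A → Carrier} xs → (∀ x → f x ≈ g x) → ∑ xs f ≈ ∑ xs g
  ∑-cong xs f≈g = ∑-congᴬ (All.universal f≈g xs)

  ∑-zero : ∀ {f : A → Carrier} xs → (∀ x → f x ≈ 0#) → ∑ xs f ≈ 0#
  ∑-zero []       f≈0 = refl
  ∑-zero (x ∷ xs) f≈0 = trans (+-cong (f≈0 x) (∑-zero xs f≈0)) (+-identityˡ 0#)

  ∑-+ : ∀ (f g : A → Carrier) xs → ∑[ x ∈ xs ] (f x + g x) ≈ ∑ xs f + ∑ xs g
  ∑-+ f g []       = sym (+-identityˡ 0#)
  ∑-+ f g (x ∷ xs) = trans (+-congˡ (∑-+ f g xs)) (+-interchange _ _ _ _)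

  ∑-*ˡ : ∀ k (f : A → Carrier) xs → ∑[ x ∈ xs ] (k * f x) ≈ k * ∑ xs f
  ∑-*ˡ k f []       = sym (zeroʳ k)
  ∑-*ˡ k f (x ∷ xs) = trans (+-congˡ (∑-*ˡ k f xs)) (sym (distribˡ k (f x) _))

  ∑-*ʳ : ∀ k (f : A → Carrier) xs → ∑[ x ∈ xs ] (f x * k) ≈ ∑ xs f * k
  ∑-*ʳ k f xs = begin
    ∑[ x ∈ xs ] (f x * k) ≈⟨ ∑-cong xs (λ x → *-comm (f x) k) ⟩
    ∑[ x ∈ xs ] (k * f x) ≈⟨ ∑-*ˡ k f xs ⟩
    k * ∑ xs f            ≈⟨ *-comm k _ ⟩
    ∑ xs f * k            ∎

  ∑-swap : ∀ (F : A → B → Carrier) xs ys →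
           ∑[ x ∈ xs ] ∑[ y ∈ ys ] F x y ≈ ∑[ y ∈ ys ] ∑[ x ∈ xs ] F x y
  ∑-swap F []       ys = sym (∑-zero ys (λ _ → refl))
  ∑-swap F (x ∷ xs) ys = trans (+-congˡ (∑-swap F xs ys)) (sym (∑-+ (F x) _ ys))

  ∑-++ : ∀ (f : A → Carrier) xs ys → ∑ (xs ++ ys) f ≈ ∑ xs f + ∑ ys f
  ∑-++ f []       ys = sym (+-identityˡ _)
  ∑-++ f (x ∷ xs) ys = trans (+-congˡ (∑-++ f xs ys)) (sym (+-assoc _ _ _))

  ∑-concatMap : ∀ (f : B → Carrier) (G : A → List B) xs →
                ∑ (concatMap G xs) f ≈ ∑[ x ∈ xs ] ∑ (G x) f
  ∑-concatMap f G []       = refl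
  ∑-concatMap f G (x ∷ xs) = trans (∑-++ f (G x) _) (+-congˡ (∑-concatMap f G xs))

  ∑-map : ∀ (f : B → Carrier) (g : A → B) xs → ∑ (map g xs) f ≡ ∑ xs (f ∘ g)
  ∑-map f g xs = ≡.cong (sumL R) (≡.sym (map-∘ xs))

  ∑-filter : ∀ {P : Pred A p} (P? : Decidable P) {f : A → Carrier} xs →
             (∀ x → ¬ P x → f x ≈ 0#) → ∑ (filter P? xs) f ≈ ∑ xs f
  ∑-filter P? []       vanish = refl
  ∑-filter P? (x ∷ xs) vanish with P? x
  ... | yes _  = +-congˡ (∑-filter P? xs vanish)
  ... | no ¬Px =
    trans (∑-filter P? xs vanish) (sym (trans (+-congʳ (vanish x ¬Px)) (+-identityˡ _)))

  ∏-cong : ∀ {f g : A → Carrier} xs → (∀ x → f x ≈ g x) → ∏ xs f ≈ ∏ xs g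
  ∏-cong []       f≈g = refl
  ∏-cong (x ∷ xs) f≈g = *-cong (f≈g x) (∏-cong xs f≈g)

  ∏-ones : ∀ {f : A → Carrier} xs → (∀ x → f x ≈ 1#) → ∏ xs f ≈ 1#
  ∏-ones []       f≈1 = refl
  ∏-ones (x ∷ xs) f≈1 = trans (*-cong (f≈1 x) (∏-ones xs f≈1)) (*-identityˡ 1#)

  ∏-zero : ∀ {f : A → Carrier} {x xs} → x ∈ xs → f x ≈ 0# → ∏ xs f ≈ 0#
  ∏-zero (here ≡.refl) fx≈0 = trans (*-congʳ fx≈0) (zeroˡ _)
  ∏-zero (there x∈xs)  fx≈0 = trans (*-congˡ (∏-zero x∈xs fx≈0)) (zeroʳ _)

  ∏-* : ∀ (f g : A → Carrier) xs → ∏[ x ∈ xs ] (f x * g x) ≈ ∏ xs f * ∏ xs g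
  ∏-* f g []       = sym (*-identityˡ 1#)
  ∏-* f g (x ∷ xs) = trans (*-congˡ (∏-* f g xs)) (*-interchange _ _ _ _)

  ∏-*₂ : ∀ (f g : A → B → Carrier) xs ys →
         ∏[ x ∈ xs ] ∏[ y ∈ ys ] (f x y * g x y) ≈
         ∏[ x ∈ xs ] ∏ ys (f x) * ∏[ x ∈ xs ] ∏ ys (g x)
  ∏-*₂ f g xs ys = trans (∏-cong xs (λ x → ∏-* (f x) (g x) ys)) (∏-* _ _ xs)

  ∏-swap : ∀ (F : A → B → Carrier) xs ys →
           ∏[ x ∈ xs ] ∏[ y ∈ ys ] F x y ≈ ∏[ y ∈ ys ] ∏[ x ∈ xs ] F x y
  ∏-swap F []       ys = sym (∏-ones ys (λ _ → refl))
  ∏-swap F (x ∷ xs) ys = trans (*-congˡ (∏-swap F xs ys)) (sym (∏-* (F x) _ ys))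

  ∏-allFin-suc : ∀ {m} (f : Fin (suc m) → Carrier) →
                 ∏ (allFin (suc m)) f ≡ f zero * ∏[ i ∈ allFin m ] f (suc i)
  ∏-allFin-suc f = ≡.cong (λ fs → f zero * prodL R fs)
                          (≡.trans (map-tabulate suc f) (≡.sym (map-tabulate (λ i → i) (f ∘ suc))))

  ∏-const : ∀ m k → ∏[ _ ∈ allFin m ] k ≈ pow R k m
  ∏-const zero    k = refl
  ∏-const (suc m) k = trans (reflexive (∏-allFin-suc {m = m} (λ _ → k))) (*-congˡ (∏-const m k))

  ∑-allFuns : ∀ m (xs : List A) (g : Fin m → A → Carrier) →
              ∑[ f ∈ allFuns m xs ] ∏[ i ∈ allFin m ] g i (f i) ≈ ∏[ i ∈ allFin m ] ∑ xs (g i)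
  ∑-allFuns zero    xs g = +-identityʳ 1#
  ∑-allFuns (suc m) xs g = begin
    ∑[ f ∈ allFuns (suc m) xs ] ∏[ i ∈ allFin (suc m) ] g i (f i)
      ≈⟨ ∑-concatMap _ (λ x → map (x ∷ᶠ_) (allFuns m xs)) xs ⟩
    ∑[ x ∈ xs ] ∑[ f ∈ map (x ∷ᶠ_) (allFuns m xs) ] ∏[ i ∈ allFin (suc m) ] g i (f i)
      ≈⟨ ∑-cong xs (λ x → reflexive (∑-map _ (x ∷ᶠ_) (allFuns m xs))) ⟩
    ∑[ x ∈ xs ] ∑[ f ∈ allFuns m xs ] ∏[ i ∈ allFin (suc m) ] g i ((x ∷ᶠ f) i)
      ≈⟨ ∑-cong xs (λ x → ∑-cong (allFuns m xs) (λ f →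
           reflexive (∏-allFin-suc (λ i → g i ((x ∷ᶠ f) i))))) ⟩
    ∑[ x ∈ xs ] ∑[ f ∈ allFuns m xs ] (g zero x * ∏[ i ∈ allFin m ] g (suc i) (f i))
      ≈⟨ ∑-cong xs (λ x → ∑-*ˡ (g zero x) _ (allFuns m xs)) ⟩
    ∑[ x ∈ xs ] (g zero x * ∑[ f ∈ allFuns m xs ] ∏[ i ∈ allFin m ] g (suc i) (f i))
      ≈⟨ ∑-*ʳ _ (g zero) xs ⟩
    ∑ xs (g zero) * ∑[ f ∈ allFuns m xs ] ∏[ i ∈ allFin m ] g (suc i) (f i)
      ≈⟨ *-congˡ (∑-allFuns m xs (g ∘ suc)) ⟩
    ∑ xs (g zero) * ∏[ i ∈ allFin m ] ∑ xs (g (suc i))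
      ≡⟨ ≡.sym (∏-allFin-suc (λ i → ∑ xs (g i))) ⟩
    ∏[ i ∈ allFin (suc m) ] ∑ xs (g i) ∎

  ∑-allMatrices : ∀ m p (xs : List A) (g : Fin m → Fin p → A → Carrier) →
    ∑[ X ∈ allFuns m (allFuns p xs) ] ∏[ i ∈ allFin m ] ∏[ j ∈ allFin p ] g i j (X i j)
      ≈ ∏[ i ∈ allFin m ] ∏[ j ∈ allFin p ] ∑ xs (g i j)
  ∑-allMatrices m p xs g =
    trans (∑-allFuns m _ (λ i row → ∏[ j ∈ allFin p ] g i j (row j)))
          (∏-cong (allFin m) (λ i → ∑-allFuns p xs (g i)))

  only : ∀ {m} → Fin m → (Fin m → Carrier) → Fin m → Carrier
  only a h j = if does (a ≟ j) then h j else 1#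

  pick : ∀ {m} (a : Fin m) (h : Fin m → Carrier) → ∏ (allFin m) (only a h) ≈ h a
  pick {suc m} zero h = begin
    ∏ (allFin (suc m)) (only zero h)          ≡⟨ ∏-allFin-suc (only zero h) ⟩
    h zero * ∏ (allFin m) (only zero h ∘ suc) ≈⟨ *-congˡ (∏-ones {f = only zero h ∘ suc} (allFin m)
                                                                   (λ _ → refl)) ⟩
    h zero * 1#                               ≈⟨ *-identityʳ _ ⟩
    h zero                                    ∎
  pick {suc m} (suc a) h = begin
    ∏ (allFin (suc m)) (only (suc a) h)            ≡⟨ ∏-allFin-suc (only (suc a) h) ⟩
    1# * ∏ (allFin m) (only (suc a) h ∘ suc)       ≈⟨ *-identityˡ _ ⟩
    ∏ (allFin m) (only a (h ∘ suc))                ≈⟨ pick a (h ∘ suc) ⟩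
    h (suc a)                                      ∎

  regroup : ∀ {m} (h : Fin m → Carrier) (g : A → Fin m) ls →
            ∏[ l ∈ ls ] h (g l) ≈ ∏[ j ∈ allFin m ] pow R (h j) (length (filter (λ l → g l ≟ j) ls))
  regroup {m = m} h g [] = sym (∏-ones {f = λ _ → 1#} (allFin m) (λ _ → refl))
  regroup {A = A} {m} h g (l ∷ ls) = begin
    h (g l) * ∏[ l ∈ ls ] h (g l)
      ≈⟨ *-cong (sym (pick (g l) h)) (regroup h g ls) ⟩
    ∏ (allFin m) (only (g l) h) * ∏[ j ∈ allFin m ] pow R (h j) (count ls j)
      ≈⟨ sym (∏-* (only (g l) h) (λ j → pow R (h j) (count ls j)) (allFin m)) ⟩
    ∏[ j ∈ allFin m ] (only (g l) h j * pow R (h j) (count ls j))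
      ≈⟨ ∏-cong (allFin m) (λ j → sym (pow-cons j)) ⟩
    ∏[ j ∈ allFin m ] pow R (h j) (count (l ∷ ls) j) ∎
    where
    count : List A → Fin m → ℕ
    count ls j = length (filter (λ l → g l ≟ j) ls)
    pow-cons : ∀ j → pow R (h j) (count (l ∷ ls) j) ≈ only (g l) h j * pow R (h j) (count ls j)
    pow-cons j with does (g l ≟ j)
    ... | true  = refl
    ... | false = sym (*-identityˡ _)

  monic-integral : ∀ (xs : List A) (f w : A → Carrier) n (a : Fin n → Carrier) →
    (∀ k → k < n → ∑[ x ∈ xs ] (pow R (f x) k * w x) ≈ 0#) →
    ∑[ x ∈ xs ] (evalMonic R n a (f x) * w x) ≈ ∑[ x ∈ xs ] (pow R (f x) n * w x)
  monic-integral xs f w n a lower = begin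
    ∑[ x ∈ xs ] (evalMonic R n a (f x) * w x)
      ≈⟨ ∑-cong xs expand ⟩
    ∑[ x ∈ xs ] (pow R (f x) n * w x + ∑[ k ∈ allFin n ] (a k * (pow R (f x) (toℕ k) * w x)))
      ≈⟨ ∑-+ _ _ xs ⟩
    ∑[ x ∈ xs ] (pow R (f x) n * w x) + ∑[ x ∈ xs ] ∑[ k ∈ allFin n ] (a k * (pow R (f x) (toℕ k) * w x))
      ≈⟨ +-congˡ (trans (∑-swap _ xs (allFin n)) (∑-zero (allFin n) lower-term)) ⟩
    ∑[ x ∈ xs ] (pow R (f x) n * w x) + 0#
      ≈⟨ +-identityʳ _ ⟩
    ∑[ x ∈ xs ] (pow R (f x) n * w x) ∎
    where
    expand : ∀ x → evalMonic R n a (f x) * w x ≈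
                   pow R (f x) n * w x + ∑[ k ∈ allFin n ] (a k * (pow R (f x) (toℕ k) * w x))
    expand x = trans (distribʳ (w x) _ _)
      (+-congˡ (trans (sym (∑-*ʳ (w x) _ (allFin n))) (∑-cong (allFin n) (λ k → *-assoc _ _ _))))
    lower-term : ∀ k → ∑[ x ∈ xs ] (a k * (pow R (f x) (toℕ k) * w x)) ≈ 0#
    lower-term k = trans (∑-*ˡ (a k) _ xs) (trans (*-congˡ (lower (toℕ k) (toℕ<n k))) (zeroʳ _))

-- Indicators, unique representatives and double counting

module Indicators {c ℓ} (R : CommutativeRing c ℓ) where
  open CommutativeRing R hiding (zero)
  open import Relation.Binary.Reasoning.Setoid setoid
  open BigOperators R
  open FinMaps

  𝟙 : {P : Set p} → Dec P → Carrier
  𝟙 (yes _) = 1#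
  𝟙 (no _)  = 0#

  𝟙-cong : {P : Set p} {Q : Set q} (P? : Dec P) (Q? : Dec Q) → (P → Q) → (Q → P) → 𝟙 P? ≈ 𝟙 Q?
  𝟙-cong (yes _) (yes _) _   _   = refl
  𝟙-cong (no _)  (no _)  _   _   = refl
  𝟙-cong (yes p) (no ¬q) p→q _   = contradiction (p→q p) ¬q
  𝟙-cong (no ¬p) (yes q) _   q→p = contradiction (q→p q) ¬p

  𝟙-× : {P : Set p} {Q : Set q} (P? : Dec P) (Q? : Dec Q) → 𝟙 (P? ×-dec Q?) ≈ 𝟙 P? * 𝟙 Q?
  𝟙-× (yes _) (yes _) = sym (*-identityˡ 1#)
  𝟙-× (yes _) (no _)  = sym (zeroʳ 1#)
  𝟙-× (no _)  _       = sym (zeroˡ _)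

  𝟙-all : ∀ {m} {P : Pred (Fin m) p} (P? : Decidable P) → 𝟙 (all? P?) ≈ ∏[ i ∈ allFin m ] 𝟙 (P? i)
  𝟙-all {m = zero}  P? = 𝟙-cong (all? P?) (yes λ ()) (λ all → all) (λ all → all)
  𝟙-all {m = suc m} P? = begin
    𝟙 (all? P?)
      ≈⟨ 𝟙-cong (all? P?) (P? zero ×-dec all? (P? ∘ suc))
                (λ all → all zero , all ∘ suc) (λ (P0 , Psuc) → λ { zero → P0 ; (suc i) → Psuc i }) ⟩
    𝟙 (P? zero ×-dec all? (P? ∘ suc))
      ≈⟨ 𝟙-× (P? zero) (all? (P? ∘ suc)) ⟩
    𝟙 (P? zero) * 𝟙 (all? (P? ∘ suc))
      ≈⟨ *-congˡ (𝟙-all (P? ∘ suc)) ⟩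
    𝟙 (P? zero) * ∏[ i ∈ allFin m ] 𝟙 (P? (suc i))
      ≡⟨ ≡.sym (∏-allFin-suc (λ i → 𝟙 (P? i))) ⟩
    ∏[ i ∈ allFin (suc m) ] 𝟙 (P? i) ∎

  ∑-𝟙 : ∀ {P : Pred A p} (P? : Decidable P) xs →
        ∑[ x ∈ xs ] 𝟙 (P? x) ≈ fromℕ R (length (filter P? xs))
  ∑-𝟙 P? []       = refl
  ∑-𝟙 P? (x ∷ xs) with P? x
  ... | yes _ = +-congˡ (∑-𝟙 P? xs)
  ... | no _  = trans (+-identityˡ _) (∑-𝟙 P? xs)

  𝟙-spread : ∀ {P : Set p} {Q : Pred A q} (P? : Dec P) (Q? : Decidable Q) zs →
             (P → ∑[ z ∈ zs ] 𝟙 (Q? z) ≈ 1#) → 𝟙 P? ≈ ∑[ z ∈ zs ] 𝟙 (P? ×-dec Q? z)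
  𝟙-spread P? Q? zs once = begin
    𝟙 P?                          ≈⟨ weigh P? once ⟩
    𝟙 P? * ∑[ z ∈ zs ] 𝟙 (Q? z)   ≈⟨ sym (∑-*ˡ _ _ zs) ⟩
    ∑[ z ∈ zs ] (𝟙 P? * 𝟙 (Q? z)) ≈⟨ ∑-cong zs (λ z → sym (𝟙-× P? (Q? z))) ⟩
    ∑[ z ∈ zs ] 𝟙 (P? ×-dec Q? z) ∎
    where
    weigh : ∀ {P : Set p} (P? : Dec P) {w} → (P → w ≈ 1#) → 𝟙 P? ≈ 𝟙 P? * w
    weigh (yes p) w≈1 = sym (trans (*-congˡ (w≈1 p)) (*-identityʳ 1#))
    weigh (no _)  _   = sym (zeroˡ _)

  Once : {_~_ : Rel A r} → Decidable₂ _~_ → List A → A → Set ℓ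
  Once _~?_ xs x = ∑[ y ∈ xs ] 𝟙 (y ~? x) ≈ 1#

  once-allFin : ∀ n (j : Fin n) → Once _≟_ (allFin n) j
  once-allFin n j = begin
    ∑[ i ∈ allFin n ] 𝟙 (i ≟ j)
      ≈⟨ ∑-𝟙 (_≟ j) (allFin n) ⟩
    fromℕ R (length (filter (_≟ j) (allFin n)))
      ≡⟨ ≡.cong (fromℕ R) (hits-unique (λ i → i) j ≡.refl (λ _ e → e)) ⟩
    1# + 0#
      ≈⟨ +-identityʳ 1# ⟩
    1# ∎

  once-filter : ∀ {_~_ : Rel A r} (_~?_ : Decidable₂ _~_) {Q : Pred A q} (Q? : Decidable Q) xs {x} →
                (∀ {y} → y ~ x → Q y) → Once _~?_ xs x → Once _~?_ (filter Q? xs) x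
  once-filter _~?_ {Q} Q? xs {x} closed once = trans (∑-filter Q? xs vanish) once
    where
    vanish : ∀ y → ¬ Q y → 𝟙 (y ~? x) ≈ 0#
    vanish y ¬Qy with y ~? x
    ... | yes y~x = contradiction (closed y~x) ¬Qy
    ... | no _    = refl

  once-allFuns : ∀ {_~_ : Rel A r} (_~?_ : Decidable₂ _~_) m xs (g : Fin m → A) →
                 (∀ i → Once _~?_ xs (g i)) → Once (pointwise? _~?_) (allFuns m xs) g
  once-allFuns _~?_ m xs g once = begin
    ∑[ f ∈ allFuns m xs ] 𝟙 (pointwise? _~?_ f g)
      ≈⟨ ∑-cong (allFuns m xs) (λ f → 𝟙-all (λ i → f i ~? g i)) ⟩
    ∑[ f ∈ allFuns m xs ] ∏[ i ∈ allFin m ] 𝟙 (f i ~? g i)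
      ≈⟨ ∑-allFuns m xs (λ i y → 𝟙 (y ~? g i)) ⟩
    ∏[ i ∈ allFin m ] ∑[ y ∈ xs ] 𝟙 (y ~? g i)
      ≈⟨ ∏-ones (allFin m) once ⟩
    1# ∎

  double-count : {P : Pred A p} {Q : Pred B q} (P? : Decidable P) (Q? : Decidable Q)
    {_~_ : Rel A r} {_≃_ : Rel B s} (_~?_ : Decidable₂ _~_) (_≃?_ : Decidable₂ _≃_)
    (xs : List A) (ys : List B) (φ : A → B) (ψ : B → A) →
    (∀ x → P x → Once _≃?_ ys (φ x)) → (∀ y → Q y → Once _~?_ xs (ψ y)) →
    (∀ {x y} → P x → y ≃ φ x → Q y × x ~ ψ y) →
    (∀ {x y} → Q y → x ~ ψ y → P x × y ≃ φ x) →
    ∑[ x ∈ xs ] 𝟙 (P? x) ≈ ∑[ y ∈ ys ] 𝟙 (Q? y)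
  double-count P? Q? _~?_ _≃?_ xs ys φ ψ onceφ onceψ to from = begin
    ∑[ x ∈ xs ] 𝟙 (P? x)
      ≈⟨ ∑-cong xs (λ x → 𝟙-spread (P? x) (_≃? φ x) ys (onceφ x)) ⟩
    ∑[ x ∈ xs ] ∑[ y ∈ ys ] 𝟙 (P? x ×-dec y ≃? φ x)
      ≈⟨ ∑-cong xs (λ x → ∑-cong ys (λ y →
           𝟙-cong (P? x ×-dec y ≃? φ x) (Q? y ×-dec x ~? ψ y) (uncurry to) (uncurry from))) ⟩
    ∑[ x ∈ xs ] ∑[ y ∈ ys ] 𝟙 (Q? y ×-dec x ~? ψ y)
      ≈⟨ ∑-swap _ xs ys ⟩
    ∑[ y ∈ ys ] ∑[ x ∈ xs ] 𝟙 (Q? y ×-dec x ~? ψ y)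
      ≈⟨ ∑-cong ys (λ y → sym (𝟙-spread (Q? y) (_~? ψ y) xs (onceψ y))) ⟩
    ∑[ y ∈ ys ] 𝟙 (Q? y) ∎

module LatinCount {c ℓ} (R : CommutativeRing c ℓ) (n : ℕ) where
  open CommutativeRing R hiding (zero)
  open import Relation.Binary.Reasoning.Setoid setoid
  open BigOperators R
  open Indicators R
  open FinMaps
  open Covers
  open LatinTuples n

  tuples : List (Fin n → Fin n → Fin n)
  tuples = allFuns n (perms n)

  arrays : List (Array n)
  arrays = allFuns n (allFuns n (allFin n))

  _≋?_ : Decidable₂ _≋_
  _≋?_ = pointwise? (pointwise? _≟_)

  -- a permutation occurs once in perms n, as IsPerm respects ≗
  once-perms : ∀ {σ} → IsPerm σ → Once (pointwise? _≟_) (perms n) σ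
  once-perms {σ} (injective , onto) =
    once-filter (pointwise? _≟_) isPerm? (allFuns n (allFin n)) perm-closed
      (once-allFuns _≟_ n (allFin n) σ (λ i → once-allFin n (σ i)))
    where
    perm-closed : ∀ {σ'} → Pointwise _≡_ σ' σ → IsPerm σ'
    perm-closed σ'≗σ = (λ i j e → injective i j (≡.trans (≡.sym (σ'≗σ i)) (≡.trans e (σ'≗σ j))))
                     , (λ k → proj₁ (onto k) , ≡.trans (σ'≗σ _) (proj₂ (onto k)))

  once-tuples : ∀ {τ} → (∀ l → IsPerm (τ l)) → Once _≋?_ tuples τ
  once-tuples {τ} perm = once-allFuns (pointwise? _≟_) n (perms n) τ (λ l → once-perms (perm l))

  once-arrays : ∀ M → Once _≋?_ arrays M
  once-arrays M = once-allFuns (pointwise? _≟_) n _ M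
                    (λ i → once-allFuns _≟_ n (allFin n) (M i) (λ j → once-allFin n (M i j)))

  tuples-perm : All (λ τ → ∀ l → IsPerm (τ l)) tuples
  tuples-perm = allFuns-All n (all-filter isPerm? (allFuns n (allFin n)))

  -- L n counts the Latin tuples: double counting along square and tuple,
  -- then dropping the permutation condition that holds on all of tuples
  latin-count : fromℕ R (L n) ≈ ∑[ τ ∈ tuples ] 𝟙 (oddCover? τ)
  latin-count = begin
    fromℕ R (L n)
      ≈⟨ sym (∑-𝟙 isLatin? arrays) ⟩
    ∑[ M ∈ arrays ] 𝟙 (isLatin? M)
      ≈⟨ sym (double-count latinTuple? isLatin? _≋?_ _≋?_ tuples arrays square tuple
                (λ τ _ → once-arrays (square τ))
                (λ M latin → once-tuples (proj₁ (tuple-latinTuple latin (λ _ _ → ≡.refl))))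
                square-tuple tuple-square) ⟩
    ∑[ τ ∈ tuples ] 𝟙 (latinTuple? τ)
      ≈⟨ ∑-congᴬ (All.map (λ {τ} perm → 𝟙-cong (latinTuple? τ) (oddCover? τ) proj₂ (perm ,_))
                          tuples-perm) ⟩
    ∑[ τ ∈ tuples ] 𝟙 (oddCover? τ) ∎

-- The moments ∑_X Per(X)^k π(X) over all ±1 matrices

module PermanentMoments {c ℓ} (R : CommutativeRing c ℓ) (n : ℕ) where
  open CommutativeRing R hiding (zero)
  open import Relation.Binary.Reasoning.Setoid setoid
  open import Algebra.Properties.Ring ring using (-1*x≈-x; -‿involutive)
  open import Algebra.Properties.Semiring.Exp semiring using (_^_; ^-assocʳ)
  open BigOperators R
  open Indicators R
  open FinMaps
  open Covers

  sign : PM → Carrier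
  sign = ⟦_⟧ R

  diagonal : SignMatrix n → (Fin n → Fin n) → Carrier
  diagonal X σ = ∏[ i ∈ allFin n ] sign (X i (σ i))

  moment : ℕ → Carrier
  moment k = ∑[ X ∈ allSignMatrices n ] (pow R (Per R X) k * πX R X)

  signMoment : ℕ → Carrier
  signMoment c = ∑[ s ∈ allPM ] pow R (sign s) (suc c)

  cellWeight : ∀ {k} → (Fin k → Fin n → Fin n) → Carrier
  cellWeight τ = ∏[ i ∈ allFin n ] ∏[ j ∈ allFin n ] signMoment (cover τ i j)

  pow-Per : ∀ k X → pow R (Per R X) k ≈ ∑[ τ ∈ allFuns k (perms n) ] ∏[ l ∈ allFin k ] diagonal X (τ l)
  pow-Per k X = trans (sym (∏-const k (Per R X))) (sym (∑-allFuns k (perms n) (λ _ → diagonal X)))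

  weight : ∀ {k} X (τ : Fin k → Fin n → Fin n) →
    ∏[ l ∈ allFin k ] diagonal X (τ l) * πX R X ≈
    ∏[ i ∈ allFin n ] ∏[ j ∈ allFin n ] pow R (sign (X i j)) (suc (cover τ i j))
  weight {k} X τ = begin
    ∏[ l ∈ allFin k ] ∏[ i ∈ allFin n ] sign (X i (τ l i)) * πX R X
      ≈⟨ *-congʳ (∏-swap _ (allFin k) (allFin n)) ⟩
    ∏[ i ∈ allFin n ] ∏[ l ∈ allFin k ] sign (X i (τ l i)) * πX R X
      ≈⟨ *-congʳ (∏-cong (allFin n) (λ i → regroup (sign ∘ X i) (λ l → τ l i) (allFin k))) ⟩
    ∏[ i ∈ allFin n ] ∏[ j ∈ allFin n ] pow R (sign (X i j)) (cover τ i j) *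
      ∏[ i ∈ allFin n ] ∏[ j ∈ allFin n ] sign (X i j)
      ≈⟨ sym (∏-*₂ _ _ (allFin n) (allFin n)) ⟩
    ∏[ i ∈ allFin n ] ∏[ j ∈ allFin n ] (pow R (sign (X i j)) (cover τ i j) * sign (X i j))
      ≈⟨ ∏-cong (allFin n) (λ i → ∏-cong (allFin n) (λ j → *-comm _ _)) ⟩
    ∏[ i ∈ allFin n ] ∏[ j ∈ allFin n ] pow R (sign (X i j)) (suc (cover τ i j)) ∎

  moment-expansion : ∀ k →
    moment k ≈ ∑[ τ ∈ allFuns k (perms n) ] cellWeight τ
  moment-expansion k = begin
    ∑[ X ∈ signs ] (pow R (Per R X) k * πX R X)
      ≈⟨ ∑-cong signs (λ X → *-congʳ (pow-Per k X)) ⟩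
    ∑[ X ∈ signs ] (∑[ τ ∈ tuples ] ∏[ l ∈ allFin k ] diagonal X (τ l) * πX R X)
      ≈⟨ ∑-cong signs (λ X → sym (∑-*ʳ _ _ tuples)) ⟩
    ∑[ X ∈ signs ] ∑[ τ ∈ tuples ] (∏[ l ∈ allFin k ] diagonal X (τ l) * πX R X)
      ≈⟨ ∑-swap _ signs tuples ⟩
    ∑[ τ ∈ tuples ] ∑[ X ∈ signs ] (∏[ l ∈ allFin k ] diagonal X (τ l) * πX R X)
      ≈⟨ ∑-cong tuples (λ τ → trans (∑-cong signs (λ X → weight X τ))
                                     (∑-allMatrices n n allPM (λ i j s → pow R (sign s) (suc (cover τ i j))))) ⟩
    ∑[ τ ∈ tuples ] cellWeight τ ∎
    where
    signs : List (SignMatrix n)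
    signs = allSignMatrices n
    tuples : List (Fin k → Fin n → Fin n)
    tuples = allFuns k (perms n)

  one-pow-step : ∀ m → pow R 1# (suc (suc m)) ≈ pow R 1# m
  one-pow-step m = trans (*-identityˡ _) (*-identityˡ _)

  neg-one-pow-step : ∀ m → pow R (- 1#) (suc (suc m)) ≈ pow R (- 1#) m
  neg-one-pow-step m = trans (-1*x≈-x _) (trans (-‿cong (-1*x≈-x _)) (-‿involutive _))

  signMoment-step : ∀ c → signMoment (suc (suc c)) ≈ signMoment c
  signMoment-step c = +-cong (one-pow-step (suc c)) (+-congʳ (neg-one-pow-step (suc c)))

  signMoment-even : ∀ c → parity c ≡ 0ℙ → signMoment c ≈ 0#
  signMoment-even zero          _    =
    trans (+-cong (*-identityʳ 1#) (trans (+-identityʳ _) (*-identityʳ _))) (-‿inverseʳ 1#)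
  signMoment-even (suc zero)    ()
  signMoment-even (suc (suc c)) even = trans (signMoment-step c) (signMoment-even c even)

  signMoment-odd : ∀ c → parity c ≡ 1ℙ → signMoment c ≈ 1# + 1#
  signMoment-odd zero          ()
  signMoment-odd (suc zero)    _   = +-cong (one-pow-step 0) (trans (+-identityʳ _) (neg-one-pow-step 0))
  signMoment-odd (suc (suc c)) odd = trans (signMoment-step c) (signMoment-odd c odd)

  -- Moments of order k < n vanish: some cell of a fixed row is covered by no τ_l.
  moment-vanishes : ∀ k → k < n → moment k ≈ 0#
  moment-vanishes k k<n = trans (moment-expansion k) (∑-zero (allFuns k (perms n)) vanish)
    where
    row : Fin n
    row = fromℕ< k<n
    vanish : ∀ (τ : Fin k → Fin n → Fin n) → cellWeight τ ≈ 0#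
    vanish τ with misses (λ l → τ l row) k<n
    ... | j , missed = ∏-zero (∈-allFin row) (∏-zero (∈-allFin j) (signMoment-even (cover τ row j) even))
      where
      even : parity (cover τ row j) ≡ 0ℙ
      even = ≡.cong parity (hits-none (λ l → τ l row) missed)

  module _ (half : Carrier) (half-inverse : half * (1# + 1#) ≈ 1#) where

    half-signMoment : ∀ c → half * signMoment c ≈ 𝟙 (parity c ≟ℙ 1ℙ)
    half-signMoment c with parity c in eq
    ... | 0ℙ = trans (*-congˡ (signMoment-even c eq)) (zeroʳ half)
    ... | 1ℙ = trans (*-congˡ (signMoment-odd c eq)) half-inverse

    half-square : pow R half (n ℕ.* n) ≈ ∏[ i ∈ allFin n ] ∏[ j ∈ allFin n ] half
    half-square = begin
      pow R half (n ℕ.* n)      ≡⟨ pow≡^ half (n ℕ.* n) ⟩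
      half ^ (n ℕ.* n)          ≈⟨ sym (^-assocʳ half n n) ⟩
      (half ^ n) ^ n            ≡⟨ ≡.cong (_^ n) (≡.sym (pow≡^ half n)) ⟩
      pow R half n ^ n          ≡⟨ ≡.sym (pow≡^ (pow R half n) n) ⟩
      pow R (pow R half n) n    ≈⟨ sym (∏-const n _) ⟩
      ∏[ i ∈ allFin n ] pow R half n ≈⟨ sym (∏-cong (allFin n) (λ _ → ∏-const n half)) ⟩
      ∏[ i ∈ allFin n ] ∏[ j ∈ allFin n ] half ∎
      where
      pow≡^ : ∀ x m → pow R x m ≡ x ^ m
      pow≡^ x zero    = ≡.refl
      pow≡^ x (suc m) = ≡.cong (x *_) (pow≡^ x m)

    top-moment : pow R half (n ℕ.* n) * moment n ≈ ∑[ τ ∈ allFuns n (perms n) ] 𝟙 (oddCover? τ)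
    top-moment = begin
      pow R half (n ℕ.* n) * moment n
        ≈⟨ *-congˡ (moment-expansion n) ⟩
      pow R half (n ℕ.* n) * ∑[ τ ∈ tuples ] cellWeight τ
        ≈⟨ sym (∑-*ˡ _ _ tuples) ⟩
      ∑[ τ ∈ tuples ] (pow R half (n ℕ.* n) * cellWeight τ)
        ≈⟨ ∑-cong tuples normalise ⟩
      ∑[ τ ∈ tuples ] 𝟙 (oddCover? τ) ∎
      where
      tuples : List (Fin n → Fin n → Fin n)
      tuples = allFuns n (perms n)
      normalise : ∀ τ → pow R half (n ℕ.* n) * cellWeight τ ≈ 𝟙 (oddCover? τ)
      normalise τ = begin
        pow R half (n ℕ.* n) * cellWeight τ
          ≈⟨ *-congʳ half-square ⟩
        ∏[ i ∈ allFin n ] ∏[ j ∈ allFin n ] half * cellWeight τ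
          ≈⟨ sym (∏-*₂ (λ _ _ → half) (λ i j → signMoment (cover τ i j)) (allFin n) (allFin n)) ⟩
        ∏[ i ∈ allFin n ] ∏[ j ∈ allFin n ] (half * signMoment (cover τ i j))
          ≈⟨ ∏-cong (allFin n) (λ i → ∏-cong (allFin n) (λ j → half-signMoment (cover τ i j))) ⟩
        ∏[ i ∈ allFin n ] ∏[ j ∈ allFin n ] 𝟙 (parity (cover τ i j) ≟ℙ 1ℙ)
          ≈⟨ sym (trans (𝟙-all (λ i → all? (λ j → parity (cover τ i j) ≟ℙ 1ℙ)))
                        (∏-cong (allFin n) (λ i → 𝟙-all (λ j → parity (cover τ i j) ≟ℙ 1ℙ)))) ⟩
        𝟙 (oddCover? τ) ∎

theorem3 : ∀ {c ℓ} (R : CommutativeRing c ℓ) →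
    let open CommutativeRing R in
    (half : Carrier) → half * (1# + 1#) ≈ 1# →
    (n : ℕ) → 1 ≤ n → (a : Fin n → Carrier) →
    fromℕ R (L n) ≈ pow R half (n ℕ.* n) *
      sumL R (map (λ X → evalMonic R n a (Per R X) * πX R X) (allSignMatrices n))
theorem3 R half half-inverse n _ a = begin
  fromℕ R (L n)
    ≈⟨ latin-count ⟩
  ∑[ τ ∈ allFuns n (perms n) ] 𝟙 (oddCover? τ)
    ≈⟨ sym (top-moment half half-inverse) ⟩
  pow R half (n ℕ.* n) * moment n
    ≈⟨ *-congˡ (sym (monic-integral (allSignMatrices n) (Per R) (πX R) n a moment-vanishes)) ⟩
  pow R half (n ℕ.* n) * ∑[ X ∈ allSignMatrices n ] (evalMonic R n a (Per R X) * πX R X) ∎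
  where
  open CommutativeRing R
  open import Relation.Binary.Reasoning.Setoid setoid
  open BigOperators R
  open Indicators R
  open Covers
  open LatinCount R n
  open PermanentMoments R n
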